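{- Let $n=mq$ with $m,q$ positive integers and $m\ge 2$. Let $d$ be a positive integer dividing $q$, and let $a_1,\ldots,a_n\in\mathbb{Z}$. Then there is a partition $I_1,\ldots,I_m$ of $\{1,\ldots,n\}$ such that for each $s=1,\ldots,m$ we have $|I_s|=q$ and $$d \ \Big|\ \sum_{i\in I_s} a_i \ \Longrightarrow\ \big|\{a_i \bmod d:\ i\in I_s\}\big|=1,$$ i.e., if the sum of the $a_i$ over $I_s$ is divisible by $d$, then all $a_i$ with $i\in I_s$ are congruent to each other modulo $d$. -}

module Defs where

open import Data.Nat using (ℕ; zero; suc)
open import Data.Fin using (Fin; zero; suc; _≟_)
open import Data.Integer using (ℤ; _+_; _-_; 0ℤ; +_)
open import Data.Integer.Divisibility using (_∣_)
open import Relation.Nullary using (yes; no)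

blockSum : ∀ {n k} → (Fin n → Fin k) → Fin k → (Fin n → ℤ) → ℤ
blockSum {zero}  f s g = 0ℤ
blockSum {suc n} f s g with f zero ≟ s
... | yes _ = g zero + blockSum (λ i → f (suc i)) s (λ i → g (suc i))
... | no  _ = blockSum (λ i → f (suc i)) s (λ i → g (suc i))

blockSize : ∀ {n k} → (Fin n → Fin k) → Fin k → ℕ
blockSize {zero}  f s = zero
blockSize {suc n} f s with f zero ≟ s
... | yes _ = suc (blockSize (λ i → f (suc i)) s)
... | no  _ = blockSize (λ i → f (suc i)) s

_≡_[mod_] : ℤ → ℤ → ℕ → Set
x ≡ y [mod d ] = (+ d) ∣ (x - y)

-- Reduce every a i to its residue in Fin d.  A block is then described by how many of its
-- elements lie in each residue class, a vector v : Fin d → ℕ whose block sum is congruent to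
-- weight v = Σ r · v r; v is admissible when d ∤ weight v or v uses a single residue.  It
-- suffices to split the residue counts c (Σ c = m q) into m admissible vectors of size q, two at a
-- time, and to realise the resulting table by a greedy assignment of the indices.  If some
-- residue b occurs at least q times, q copies of b form one block (constant, of weight b q ≡ 0);
-- the rest is admissible unless d divides the total weight, and then exchanging one b for another
-- residue makes both weights nonzero mod d.  Otherwise three distinct residues occur; put two of
-- them in the first block and the third in the second, filling up with a fixed split of the
-- remaining elements: over the three choices each block has divisible weight at most once.

module Submission where

open import Defs
open import Algebra.Properties.CommutativeMonoid.Sum as Sum using ()
open import Algebra.Properties.CommutativeSemigroup as CommutativeSemigroupProperties using ()
open import Data.Empty using (⊥-elim)
open import Data.Fin using (Fin; zero; suc; toℕ; fromℕ<; _≟_)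
open import Data.Fin.Properties using (toℕ-injective; toℕ<n; toℕ-fromℕ<; any?)
open import Data.Integer as ℤ using (ℤ; +_)
open import Data.Integer.Divisibility as ℤDiv using ()
import Data.Integer.Divisibility.Signed as ℤ∣
open import Data.Integer.DivMod using (_/ℕ_; n%ℕd<d; a≡a%ℕn+[a/ℕn]*n)
import Data.Integer.Properties as ℤ
import Data.Integer.Tactic.RingSolver as ℤSolver
open import Data.Nat
  using (ℕ; zero; suc; _+_; _*_; _∸_; _≤_; _<_; _≤?_; _<?_; z≤n; s≤s; z<s; pred; NonZero; >-nonZero⁻¹)
open import Data.Nat.Divisibility using (_∣_; _∣?_; ∣m+n∣m⇒∣n; ∣m∣n⇒∣m+n; ∣⇒≤; ∣-trans; n∣m*n)
open import Data.Nat.Properties hiding (_≟_)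
open import Data.Nat.Tactic.RingSolver using (solve-∀)
open import Data.Product using (Σ; ∃-syntax; _×_; _,_; proj₁; proj₂)
open import Data.Sum using (inj₁; inj₂)
open import Data.Vec.Functional using ([]; _∷_)
open import Function using (_∘_)
open import Relation.Binary.PropositionalEquality
open import Relation.Nullary using (¬_; yes; no; ¬?)
open import Relation.Nullary.Decidable using (_×-dec_)

open Sum +-0-commutativeMonoid using (sum; sum-cong-≗; ∑-distrib-+; sum-replicate-zero)
open CommutativeSemigroupProperties +-commutativeSemigroup using (x∙yz≈y∙xz; xy∙z≈xz∙y)

private variable
  n k : ℕ

pointMass : Fin n → ℕ → Fin n → ℕ
pointMass zero    k zero    = k
pointMass zero    k (suc j) = 0
pointMass (suc i) k zero    = 0
pointMass (suc i) k (suc j) = pointMass i k j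

pointMass-self : ∀ (i : Fin n) k → pointMass i k i ≡ k
pointMass-self zero    k = refl
pointMass-self (suc i) k = pointMass-self i k

pointMass-other : ∀ {i j : Fin n} k → j ≢ i → pointMass i k j ≡ 0
pointMass-other {i = zero}  {zero}  k j≢i = ⊥-elim (j≢i refl)
pointMass-other {i = zero}  {suc j} k j≢i = refl
pointMass-other {i = suc i} {zero}  k j≢i = refl
pointMass-other {i = suc i} {suc j} k j≢i = pointMass-other k (j≢i ∘ cong suc)

pointMass-+ : ∀ (i j : Fin n) k l → pointMass i (k + l) j ≡ pointMass i k j + pointMass i l j
pointMass-+ zero    zero    k l = refl
pointMass-+ zero    (suc j) k l = refl
pointMass-+ (suc i) zero    k l = refl
pointMass-+ (suc i) (suc j) k l = pointMass-+ i j k l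

pointMass-≤ : ∀ {c : Fin n → ℕ} {i} {k} → k ≤ c i → ∀ j → pointMass i k j ≤ c j
pointMass-≤ {i = zero}  k≤ci zero    = k≤ci
pointMass-≤ {i = zero}  k≤ci (suc j) = z≤n
pointMass-≤ {i = suc i} k≤ci zero    = z≤n
pointMass-≤ {c = c} {i = suc i} k≤ci (suc j) = pointMass-≤ {c = c ∘ suc} k≤ci j

sum-≗0 : ∀ (c : Fin n → ℕ) → (∀ i → c i ≡ 0) → sum c ≡ 0
sum-≗0 {zero}  c c≗0 = refl
sum-≗0 {suc n} c c≗0 = cong₂ _+_ (c≗0 zero) (sum-≗0 (c ∘ suc) (c≗0 ∘ suc))

sum-pointMass : ∀ (i : Fin n) k → sum (pointMass i k) ≡ k
sum-pointMass {suc n} zero    k = trans (cong (_+_ k) (sum-≗0 {n} (pointMass zero k ∘ suc) λ _ → refl)) (+-identityʳ k)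
sum-pointMass         (suc i) k = sum-pointMass i k

sum-mono-≤ : ∀ {u v : Fin n → ℕ} → (∀ i → u i ≤ v i) → sum u ≤ sum v
sum-mono-≤ {zero}  u≤v = z≤n
sum-mono-≤ {suc n} u≤v = +-mono-≤ (u≤v zero) (sum-mono-≤ (u≤v ∘ suc))

sum-split : ∀ {u v w : Fin n → ℕ} → (∀ i → u i + v i ≡ w i) → sum u + sum v ≡ sum w
sum-split {u = u} {v} u+v≗w = trans (sym (∑-distrib-+ u v)) (sum-cong-≗ u+v≗w)

sum≡0⇒≡0 : ∀ (c : Fin n → ℕ) → sum c ≡ 0 → ∀ i → c i ≡ 0
sum≡0⇒≡0 c eq zero    = m+n≡0⇒m≡0 (c zero) eq
sum≡0⇒≡0 c eq (suc i) = sum≡0⇒≡0 (c ∘ suc) (m+n≡0⇒n≡0 (c zero) eq) i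

weight : (Fin n → ℕ) → ℕ
weight v = sum (λ r → toℕ r * v r)

weight-split : ∀ {u v w : Fin n → ℕ} → (∀ i → u i + v i ≡ w i) → weight u + weight v ≡ weight w
weight-split {u = u} {v} u+v≗w = trans (sym (∑-distrib-+ (λ r → toℕ r * u r) (λ r → toℕ r * v r)))
  (sum-cong-≗ λ r → trans (sym (*-distribˡ-+ (toℕ r) (u r) (v r))) (cong (toℕ r *_) (u+v≗w r)))

weight-pointMass : ∀ (i : Fin n) k → weight (pointMass i k) ≡ toℕ i * k
weight-pointMass {suc n} zero    k = sum-≗0 {n} (λ j → toℕ (suc j) * 0) (λ j → *-zeroʳ (toℕ (suc j)))
weight-pointMass         (suc i) k = begin
  sum (λ j → pointMass i k j + toℕ j * pointMass i k j) ≡⟨ ∑-distrib-+ (pointMass i k) _ ⟩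
  sum (pointMass i k) + weight (pointMass i k)           ≡⟨ cong₂ _+_ (sum-pointMass i k) (weight-pointMass i k) ⟩
  k + toℕ i * k                                          ∎
  where open ≡-Reasoning

weight-cong : ∀ {u v : Fin n → ℕ} → (∀ r → u r ≡ v r) → weight u ≡ weight v
weight-cong u≗v = sum-cong-≗ (λ r → cong (toℕ r *_) (u≗v r))

weight-zero : weight {n} (λ _ → 0) ≡ 0
weight-zero {n} = sum-≗0 {n} (λ r → toℕ r * 0) (λ r → *-zeroʳ (toℕ r))

weight-unit : ∀ (i : Fin n) → weight (pointMass i 1) ≡ toℕ i
weight-unit i = trans (weight-pointMass i 1) (*-identityʳ (toℕ i))

weight-+ : ∀ (u v : Fin n → ℕ) → weight (λ r → u r + v r) ≡ weight u + weight v
weight-+ u v = sym (weight-split {u = u} {v} (λ _ → refl))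

removeMass : Fin n → ℕ → (Fin n → ℕ) → Fin n → ℕ
removeMass i k c j = c j ∸ pointMass i k j

pointMass+removeMass : ∀ {c : Fin n → ℕ} i k → k ≤ c i → ∀ j → pointMass i k j + removeMass i k c j ≡ c j
pointMass+removeMass {c = c} i k k≤ci j = m+[n∸m]≡n (pointMass-≤ {c = c} {i} k≤ci j)

sum-removeMass : ∀ {c : Fin n → ℕ} i k → k ≤ c i → k + sum (removeMass i k c) ≡ sum c
sum-removeMass {c = c} i k k≤ci =
  trans (cong (_+ sum (removeMass i k c)) (sym (sum-pointMass i k))) (sum-split (pointMass+removeMass i k k≤ci))

removeMass-other : ∀ {c : Fin n → ℕ} {i j} k → j ≢ i → removeMass i k c j ≡ c j
removeMass-other {c = c} {j = j} k j≢i = cong (c j ∸_) (pointMass-other k j≢i)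

pointMass-pull : ∀ {m} (F : (Fin m → ℕ) → ℕ) → (∀ {u v} → (∀ r → u r ≡ v r) → F u ≡ F v) →
                 F (λ _ → 0) ≡ 0 →
                 ∀ (i j : Fin n) (g : Fin m → ℕ) → F (λ r → pointMass i (g r) j) ≡ pointMass i (F g) j
pointMass-pull F F-cong F0≡0 i j g with j ≟ i
... | yes refl = trans (F-cong (λ r → pointMass-self i (g r))) (sym (pointMass-self i (F g)))
... | no  j≢i  = trans (F-cong (λ r → pointMass-other (g r) j≢i)) (trans F0≡0 (sym (pointMass-other (F g) j≢i)))

∃-positive : ∀ (c : Fin n → ℕ) → 0 < sum c → ∃[ i ] 0 < c i
∃-positive {suc n} c pos with c zero in eq
... | suc _ = zero , subst (0 <_) (sym eq) z<s
... | zero  with i , pos′ ← ∃-positive (c ∘ suc) pos = suc i , pos′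

positive-outside : ∀ (c : Fin n → ℕ) j k → c j + c k < sum c → ∃[ i ] i ≢ j × i ≢ k × 0 < c i
positive-outside c j k cj+ck<sum with any? (λ i → ¬? (i ≟ j) ×-dec ¬? (i ≟ k) ×-dec 0 <? c i)
... | yes found = found
... | no  none  = ⊥-elim (<⇒≱ cj+ck<sum (begin
  sum c                                           ≤⟨ sum-mono-≤ bounded ⟩
  sum (λ i → pointMass j (c j) i + pointMass k (c k) i) ≡⟨ ∑-distrib-+ (pointMass j (c j)) (pointMass k (c k)) ⟩
  sum (pointMass j (c j)) + sum (pointMass k (c k))     ≡⟨ cong₂ _+_ (sum-pointMass j (c j)) (sum-pointMass k (c k)) ⟩
  c j + c k                                             ∎))
  where
  open ≤-Reasoning
  bounded : ∀ i → c i ≤ pointMass j (c j) i + pointMass k (c k) i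
  bounded i with i ≟ j | i ≟ k
  ... | yes refl | _        = ≤-trans (≤-reflexive (sym (pointMass-self i (c i)))) (m≤m+n _ _)
  ... | no  _    | yes refl = ≤-trans (≤-reflexive (sym (pointMass-self i (c i)))) (m≤n+m _ _)
  ... | no  i≢j  | no  i≢k  = ≤-trans (≮⇒≥ (λ pos → none (i , i≢j , i≢k , pos))) z≤n

multiple<⇒≡0 : ∀ {d m} → d ∣ m → m < d → m ≡ 0
multiple<⇒≡0 {m = zero}  _   _   = refl
multiple<⇒≡0 {m = suc m} d∣m m<d = ⊥-elim (<⇒≱ m<d (∣⇒≤ d∣m))

∣+-≤-unique : ∀ {d a b} m → a ≤ b → b < d → d ∣ a + m → d ∣ b + m → a ≡ b
∣+-≤-unique {d} {a} {b} m a≤b b<d d∣a+m d∣b+m =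
  ≤-antisym a≤b (m∸n≡0⇒m≤n (multiple<⇒≡0 d∣gap (≤-<-trans (m∸n≤m b a) b<d)))
  where
  b+m≡a+m+gap : b + m ≡ a + m + (b ∸ a)
  b+m≡a+m+gap = trans (cong (_+ m) (sym (m+[n∸m]≡n a≤b))) (xy∙z≈xz∙y a (b ∸ a) m)
  d∣gap : d ∣ b ∸ a
  d∣gap = ∣m+n∣m⇒∣n (subst (d ∣_) b+m≡a+m+gap d∣b+m) d∣a+m

∣toℕ+-injective : ∀ {d} (x y : Fin d) m → d ∣ toℕ x + m → d ∣ toℕ y + m → x ≡ y
∣toℕ+-injective x y m d∣x+m d∣y+m with ≤-total (toℕ x) (toℕ y)
... | inj₁ x≤y = toℕ-injective (∣+-≤-unique m x≤y (toℕ<n y) d∣x+m d∣y+m)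
... | inj₂ y≤x = sym (toℕ-injective (∣+-≤-unique m y≤x (toℕ<n x) d∣y+m d∣x+m))

record Split (c : Fin n → ℕ) (k l : ℕ) : Set where
  constructor mkSplit
  field
    first second : Fin n → ℕ
    first+second : ∀ i → first i + second i ≡ c i
    sum-first    : sum first ≡ k
    sum-second   : sum second ≡ l

split : ∀ (c : Fin n → ℕ) k l → sum c ≡ k + l → Split c k l
split {n} c zero    l sum-c = mkSplit (λ _ → 0) c (λ _ → refl) (sum-replicate-zero n) sum-c
split     c (suc k) l sum-c with i , ci-positive ← ∃-positive c (subst (0 <_) (sym sum-c) z<s) =
  mkSplit (λ j → pointMass i 1 j + first j) second first+second′ sum-first′ sum-second
  where
  open Split (split (removeMass i 1 c) k l (suc-injective (trans (sum-removeMass i 1 ci-positive) sum-c)))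
  first+second′ : ∀ j → pointMass i 1 j + first j + second j ≡ c j
  first+second′ j = trans (+-assoc (pointMass i 1 j) (first j) (second j))
    (trans (cong (_+_ (pointMass i 1 j)) (first+second j)) (pointMass+removeMass i 1 ci-positive j))
  sum-first′ : sum (λ j → pointMass i 1 j + first j) ≡ suc k
  sum-first′ = trans (∑-distrib-+ (pointMass i 1) first) (cong₂ _+_ (sum-pointMass i 1) sum-first)

blockSize-head : ∀ {N} (f : Fin (suc N) → Fin k) s → blockSize f s ≡ pointMass (f zero) 1 s + blockSize (f ∘ suc) s
blockSize-head f s with f zero ≟ s
... | yes refl = cong (_+ blockSize (f ∘ suc) s) (sym (pointMass-self (f zero) 1))
... | no  f0≢s = cong (_+ blockSize (f ∘ suc) s) (sym (pointMass-other 1 (f0≢s ∘ sym)))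

blockSum-head : ∀ {N} (f : Fin (suc N) → Fin k) s (g : Fin (suc N) → ℕ) →
                blockSum f s (λ i → + g i) ≡
                + pointMass (f zero) (g zero) s ℤ.+ blockSum (f ∘ suc) s (λ i → + g (suc i))
blockSum-head f s g with f zero ≟ s
... | yes refl = cong (λ x → + x ℤ.+ blockSum (f ∘ suc) s (λ i → + g (suc i)))
                      (sym (pointMass-self (f zero) (g zero)))
... | no  f0≢s = sym (trans (cong (λ x → + x ℤ.+ blockSum (f ∘ suc) s (λ i → + g (suc i)))
                                  (pointMass-other (g zero) (f0≢s ∘ sym)))
                            (ℤ.+-identityˡ _))

sum-blockSize : ∀ {N} (f : Fin N → Fin k) → sum (blockSize f) ≡ N
sum-blockSize {N = zero}  f = sum-≗0 (blockSize f) (λ _ → refl)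
sum-blockSize {N = suc N} f = trans (sym (sum-split (λ s → sym (blockSize-head f s))))
  (cong₂ _+_ (sum-pointMass (f zero) 1) (sum-blockSize (f ∘ suc)))

blockSum-linear : ∀ {N} (f : Fin N → Fin k) s {a g h : Fin N → ℤ} e → (∀ i → a i ≡ g i ℤ.+ h i ℤ.* e) →
                  blockSum f s a ≡ blockSum f s g ℤ.+ blockSum f s h ℤ.* e
blockSum-linear {N = zero}  f s e a≗ = ℤSolver.solve-∀
blockSum-linear {N = suc N} f s {a} {g} {h} e a≗ with f zero ≟ s
... | yes _ = trans (cong₂ ℤ._+_ (a≗ zero) (blockSum-linear (f ∘ suc) s e (a≗ ∘ suc)))
                    (regroup (g zero) (h zero) _ _ e)
  where
  regroup : ∀ x y X Y e → (x ℤ.+ y ℤ.* e) ℤ.+ (X ℤ.+ Y ℤ.* e) ≡ (x ℤ.+ X) ℤ.+ (y ℤ.+ Y) ℤ.* e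
  regroup = ℤSolver.solve-∀
... | no  _ = blockSum-linear (f ∘ suc) s e (a≗ ∘ suc)

ColourCounts : ∀ {N d m} → (Fin N → Fin d) → (Fin m → Fin d → ℕ) → Set
ColourCounts col M = ∀ r → sum (λ s → M s r) ≡ blockSize col r

module RealiseStep {N d m} (col : Fin (suc N) → Fin d) (M : Fin m → Fin d → ℕ) (counts : ColourCounts col M) where

  r₀ : Fin d
  r₀ = col zero

  column-positive : 0 < sum (λ s → M s r₀)
  column-positive = subst (0 <_) (sym (trans (counts r₀) (trans (blockSize-head col r₀)
    (cong (_+ blockSize (col ∘ suc) r₀) (pointMass-self r₀ 1))))) z<s

  s₀ : Fin m
  s₀ = proj₁ (∃-positive (λ s → M s r₀) column-positive)

  s₀-positive : 0 < M s₀ r₀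
  s₀-positive = proj₂ (∃-positive (λ s → M s r₀) column-positive)

  -- M with the entry at (s₀, r₀) lowered by one
  M′ : Fin m → Fin d → ℕ
  M′ s r = removeMass s₀ (pointMass r₀ 1 r) (λ s → M s r) s

  unit+M′ : ∀ s r → pointMass s₀ (pointMass r₀ 1 r) s + M′ s r ≡ M s r
  unit+M′ s r = pointMass+removeMass s₀ (pointMass r₀ 1 r) (pointMass-≤ {c = M s₀} {r₀} s₀-positive r) s

  column-sum : ∀ r → pointMass r₀ 1 r + sum (λ s → M′ s r) ≡ sum (λ s → M s r)
  column-sum r = trans (cong (_+ sum (λ s → M′ s r)) (sym (sum-pointMass s₀ (pointMass r₀ 1 r))))
                       (sum-split (λ s → unit+M′ s r))

  row-sum : ∀ s → pointMass s₀ 1 s + sum (M′ s) ≡ sum (M s)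
  row-sum s = trans (cong (_+ sum (M′ s)) unit-row) (sum-split (unit+M′ s))
    where
    unit-row : pointMass s₀ 1 s ≡ sum (λ r → pointMass s₀ (pointMass r₀ 1 r) s)
    unit-row = sym (trans (pointMass-pull sum sum-cong-≗ (sum-replicate-zero d) s₀ s (pointMass r₀ 1))
                          (cong (λ x → pointMass s₀ x s) (sum-pointMass r₀ 1)))

  row-weight : ∀ s → pointMass s₀ (toℕ r₀) s + weight (M′ s) ≡ weight (M s)
  row-weight s = trans (cong (_+ weight (M′ s)) unit-row) (weight-split (unit+M′ s))
    where
    unit-row : pointMass s₀ (toℕ r₀) s ≡ weight (λ r → pointMass s₀ (pointMass r₀ 1 r) s)
    unit-row = sym (trans (pointMass-pull weight weight-cong (weight-zero {d}) s₀ s (pointMass r₀ 1))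
                          (cong (λ x → pointMass s₀ x s) (trans (weight-pointMass r₀ 1) (*-identityʳ (toℕ r₀)))))

  counts′ : ColourCounts (col ∘ suc) M′
  counts′ r = +-cancelˡ-≡ (pointMass r₀ 1 r) _ _ (trans (column-sum r) (trans (counts r) (blockSize-head col r)))

-- Row s of M prescribes how many points of each colour block s receives.
realise : ∀ {N d m} (col : Fin N → Fin d) (M : Fin m → Fin d → ℕ) → ColourCounts col M → Fin N → Fin m
realise col M counts zero    = RealiseStep.s₀ col M counts
realise col M counts (suc i) = realise (col ∘ suc) (RealiseStep.M′ col M counts) (RealiseStep.counts′ col M counts) i

entries-vanish : ∀ {d m} (col : Fin 0 → Fin d) (M : Fin m → Fin d → ℕ) → ColourCounts col M → ∀ s r → M s r ≡ 0
entries-vanish col M counts s r = sum≡0⇒≡0 (λ s → M s r) (counts r) s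

blockSize-realise : ∀ {N d m} (col : Fin N → Fin d) (M : Fin m → Fin d → ℕ) (counts : ColourCounts col M) s →
                    blockSize (realise col M counts) s ≡ sum (M s)
blockSize-realise {zero}  col M counts s = sym (sum-≗0 (M s) (entries-vanish col M counts s))
blockSize-realise {suc N} col M counts s = begin
  blockSize (realise col M counts) s                   ≡⟨ blockSize-head (realise col M counts) s ⟩
  pointMass s₀ 1 s + blockSize (realise (col ∘ suc) M′ counts′) s
    ≡⟨ cong (_+_ (pointMass s₀ 1 s)) (blockSize-realise (col ∘ suc) M′ counts′ s) ⟩
  pointMass s₀ 1 s + sum (M′ s)                        ≡⟨ row-sum s ⟩
  sum (M s)                                            ∎
  where
  open RealiseStep col M counts
  open ≡-Reasoning

blockSum-realise : ∀ {N d m} (col : Fin N → Fin d) (M : Fin m → Fin d → ℕ) (counts : ColourCounts col M) s →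
                   blockSum (realise col M counts) s (λ i → + toℕ (col i)) ≡ + weight (M s)
blockSum-realise {zero} {d} col M counts s =
  cong +_ (sym (trans (weight-cong (entries-vanish col M counts s)) (weight-zero {d})))
blockSum-realise {suc N} col M counts s = begin
  blockSum (realise col M counts) s (λ i → + toℕ (col i))
    ≡⟨ blockSum-head (realise col M counts) s (toℕ ∘ col) ⟩
  + pointMass s₀ (toℕ r₀) s ℤ.+ blockSum (realise (col ∘ suc) M′ counts′) s (λ i → + toℕ (col (suc i)))
    ≡⟨ cong (ℤ._+_ (+ pointMass s₀ (toℕ r₀) s)) (blockSum-realise (col ∘ suc) M′ counts′ s) ⟩
  + (pointMass s₀ (toℕ r₀) s + weight (M′ s))
    ≡⟨ cong +_ (row-weight s) ⟩
  + weight (M s) ∎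
  where
  open RealiseStep col M counts
  open ≡-Reasoning

realise-positive : ∀ {N d m} (col : Fin N → Fin d) (M : Fin m → Fin d → ℕ) (counts : ColourCounts col M) i s →
                   realise col M counts i ≡ s → 0 < M s (col i)
realise-positive col M counts zero    s refl = RealiseStep.s₀-positive col M counts
realise-positive col M counts (suc i) s eq   =
  ≤-trans (realise-positive (col ∘ suc) M′ counts′ i s eq)
          (m∸n≤m (M s (col (suc i))) (pointMass s₀ (pointMass r₀ 1 (col (suc i))) s))
  where open RealiseStep col M counts

Admissible : ∀ {d} → (Fin d → ℕ) → Set
Admissible {d} v = d ∣ weight v → ∀ r r′ → 0 < v r → 0 < v r′ → r ≡ r′

admissible-∤ : ∀ {d} {v : Fin d → ℕ} → ¬ d ∣ weight v → Admissible v
admissible-∤ d∤v d∣v = ⊥-elim (d∤v d∣v)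

admissible-concentrated : ∀ {d} {v : Fin d → ℕ} b → (∀ r → r ≢ b → v r ≡ 0) → Admissible v
admissible-concentrated {v = v} b vanishes _ r r′ pos pos′ = trans (on-b pos) (sym (on-b pos′))
  where
  on-b : ∀ {r} → 0 < v r → r ≡ b
  on-b {r} pos with r ≟ b
  ... | yes r≡b = r≡b
  ... | no  r≢b = ⊥-elim (<⇒≢ pos (sym (vanishes r r≢b)))

module AdmissibleBlocks {d q : ℕ} .{{_ : NonZero q}} (d∣q : d ∣ q) where

  record Halving (c : Fin d → ℕ) : Set where
    constructor mkHalving
    field
      left right       : Fin d → ℕ
      left+right       : ∀ r → left r + right r ≡ c r
      sum-left         : sum left ≡ q
      sum-right        : sum right ≡ q
      admissible-left  : Admissible left
      admissible-right : Admissible right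

  module Heavy (c : Fin d → ℕ) (sum-c : sum c ≡ q + q) (b : Fin d) (q≤cb : q ≤ c b) where

    rest : Fin d → ℕ
    rest = removeMass b q c

    sum-rest : sum rest ≡ q
    sum-rest = +-cancelˡ-≡ q _ _ (trans (sum-removeMass b q q≤cb) sum-c)

    weight-c : toℕ b * q + weight rest ≡ weight c
    weight-c = trans (cong (_+ weight rest) (sym (weight-pointMass b q))) (weight-split (pointMass+removeMass b q q≤cb))

    split-off : Admissible rest → Halving c
    split-off = mkHalving (pointMass b q) rest (pointMass+removeMass b q q≤cb) (sum-pointMass b q) sum-rest
                          (admissible-concentrated {v = pointMass b q} b (λ _ → pointMass-other q))

    exchange : ∀ s → s ≢ b → 0 < c s → d ∣ weight c → Halving c
    exchange s s≢b cs-positive d∣c =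
      mkHalving v w v+w sum-v sum-w (admissible-∤ d∤v) (admissible-∤ (λ d∣w → d∤v (d∣v d∣w)))
      where
      q′ : ℕ
      q′ = pred q
      rest′ : Fin d → ℕ
      rest′ = removeMass s 1 rest
      v w : Fin d → ℕ
      v r = pointMass b q′ r + pointMass s 1 r
      w r = pointMass b 1 r + rest′ r

      rest-s-positive : 0 < rest s
      rest-s-positive = subst (0 <_) (sym (removeMass-other {c = c} q s≢b)) cs-positive

      v+w : ∀ r → v r + w r ≡ c r
      v+w r = begin
        (pointMass b q′ r + pointMass s 1 r) + (pointMass b 1 r + rest′ r)
          ≡⟨ regroup (pointMass b q′ r) (pointMass s 1 r) (pointMass b 1 r) (rest′ r) ⟩
        (pointMass b 1 r + pointMass b q′ r) + (pointMass s 1 r + rest′ r)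
          ≡⟨ cong₂ _+_ (sym (pointMass-+ b r 1 q′)) (pointMass+removeMass s 1 rest-s-positive r) ⟩
        pointMass b (suc q′) r + rest r
          ≡⟨ cong (λ k → pointMass b k r + rest r) (suc-pred q) ⟩
        pointMass b q r + rest r
          ≡⟨ pointMass+removeMass b q q≤cb r ⟩
        c r ∎
        where
        open ≡-Reasoning
        regroup : ∀ x y z t → (x + y) + (z + t) ≡ (z + x) + (y + t)
        regroup = solve-∀

      sum-v : sum v ≡ q
      sum-v = trans (∑-distrib-+ (pointMass b q′) (pointMass s 1))
                    (trans (cong₂ _+_ (sum-pointMass b q′) (sum-pointMass s 1)) (trans (+-comm q′ 1) (suc-pred q)))

      sum-w : sum w ≡ q
      sum-w = trans (∑-distrib-+ (pointMass b 1) rest′)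
                    (trans (cong (_+ sum rest′) (sum-pointMass b 1)) (trans (sum-removeMass s 1 rest-s-positive) sum-rest))

      -- weight v = b (q − 1) + s ≡ s − b (mod d) because d ∣ b q
      d∤v : ¬ d ∣ weight v
      d∤v d∣v = s≢b (∣toℕ+-injective s b (toℕ b * q′) d∣s+bq′ d∣b+bq′)
        where
        d∣s+bq′ : d ∣ toℕ s + toℕ b * q′
        d∣s+bq′ = subst (d ∣_) (trans (weight-+ (pointMass b q′) (pointMass s 1))
                                     (trans (cong₂ _+_ (weight-pointMass b q′) (weight-unit s)) (+-comm _ (toℕ s)))) d∣v
        d∣b+bq′ : d ∣ toℕ b + toℕ b * q′
        d∣b+bq′ = subst (d ∣_) (trans (cong (toℕ b *_) (sym (suc-pred q))) (*-suc (toℕ b) q′))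
                        (∣-trans d∣q (n∣m*n (toℕ b)))

      d∣v : d ∣ weight w → d ∣ weight v
      d∣v d∣w = ∣m+n∣m⇒∣n (subst (d ∣_) w+v≡c d∣c) d∣w
        where
        w+v≡c : weight c ≡ weight w + weight v
        w+v≡c = sym (trans (+-comm (weight w) (weight v)) (weight-split v+w))

    halve : Halving c
    halve with d ∣? weight c
    ... | no d∤c = split-off (admissible-∤ λ d∣rest →
                     d∤c (subst (d ∣_) weight-c (∣m∣n⇒∣m+n (∣-trans d∣q (n∣m*n (toℕ b))) d∣rest)))
    ... | yes d∣c with any? (λ s → ¬? (s ≟ b) ×-dec 0 <? c s)
    ...   | yes (s , s≢b , cs-positive) = exchange s s≢b cs-positive d∣c
    ...   | no  none = split-off (admissible-concentrated {v = rest} b λ r r≢b →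
                         trans (removeMass-other {c = c} q r≢b) (n≤0⇒n≡0 (≮⇒≥ (λ pos → none (r , r≢b , pos)))))

  module Triple (c : Fin d → ℕ) {p t u : Fin d} (t≢p : t ≢ p) (u≢p : u ≢ p) (u≢t : u ≢ t) (R : Fin d → ℕ)
                (p+t+u+R : ∀ r → pointMass p 1 r + (pointMass t 1 r + (pointMass u 1 r + R r)) ≡ c r)
                (q″ : ℕ) (2+q″≡q : 2 + q″ ≡ q) (sum-R : sum R ≡ q″ + suc q″) where

    open Split (split R q″ (suc q″) sum-R)

    A B : ℕ
    A = weight first
    B = weight second

    candidate : ∀ x y z → (∀ r → pointMass x 1 r + (pointMass y 1 r + (pointMass z 1 r + R r)) ≡ c r) →
                ¬ d ∣ toℕ x + (toℕ y + A) → ¬ d ∣ toℕ z + B → Halving c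
    candidate x y z x+y+z+R d∤x+y+A d∤z+B = mkHalving v w v+w sum-v sum-w
      (admissible-∤ (d∤x+y+A ∘ subst (d ∣_) weight-v)) (admissible-∤ (d∤z+B ∘ subst (d ∣_) weight-w))
      where
      v w : Fin d → ℕ
      v r = pointMass x 1 r + (pointMass y 1 r + first r)
      w r = pointMass z 1 r + second r

      v+w : ∀ r → v r + w r ≡ c r
      v+w r = trans (regroup (pointMass x 1 r) (pointMass y 1 r) (first r) (pointMass z 1 r) (second r))
        (trans (cong (λ k → pointMass x 1 r + (pointMass y 1 r + (pointMass z 1 r + k))) (first+second r)) (x+y+z+R r))
        where
        regroup : ∀ a b f e g → a + (b + f) + (e + g) ≡ a + (b + (e + (f + g)))
        regroup = solve-∀

      sum-v : sum v ≡ q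
      sum-v = trans (∑-distrib-+ (pointMass x 1) _) (trans (cong₂ _+_ (sum-pointMass x 1)
                (trans (∑-distrib-+ (pointMass y 1) first) (cong₂ _+_ (sum-pointMass y 1) sum-first))) 2+q″≡q)

      sum-w : sum w ≡ q
      sum-w = trans (∑-distrib-+ (pointMass z 1) second) (trans (cong₂ _+_ (sum-pointMass z 1) sum-second) 2+q″≡q)

      weight-v : weight v ≡ toℕ x + (toℕ y + A)
      weight-v = trans (weight-+ (pointMass x 1) _) (cong₂ _+_ (weight-unit x)
                   (trans (weight-+ (pointMass y 1) first) (cong (_+ A) (weight-unit y))))

      weight-w : weight w ≡ toℕ z + B
      weight-w = trans (weight-+ (pointMass z 1) second) (cong (_+ B) (weight-unit z))

    p+u+t+R : ∀ r → pointMass p 1 r + (pointMass u 1 r + (pointMass t 1 r + R r)) ≡ c r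
    p+u+t+R r = trans (cong (_+_ (pointMass p 1 r)) (x∙yz≈y∙xz (pointMass u 1 r) (pointMass t 1 r) (R r))) (p+t+u+R r)

    t+u+p+R : ∀ r → pointMass t 1 r + (pointMass u 1 r + (pointMass p 1 r + R r)) ≡ c r
    t+u+p+R r = trans (cong (_+_ (pointMass t 1 r)) (x∙yz≈y∙xz (pointMass u 1 r) (pointMass p 1 r) (R r)))
                (trans (x∙yz≈y∙xz (pointMass t 1 r) (pointMass p 1 r) _) (p+t+u+R r))

    swap : ∀ x y → d ∣ x + (y + A) → d ∣ y + (x + A)
    swap x y = subst (d ∣_) (x∙yz≈y∙xz x y A)

    -- Candidate z puts z with `second` and the other two with `first`.  By ∣toℕ+-injective at most
    -- one candidate has a first block of divisible weight, and at most one a second.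
    halve : Halving c
    halve with d ∣? (toℕ p + B)
    ... | yes d∣p+B with d ∣? (toℕ p + (toℕ u + A))
    ...   | no  d∤p+u+A = candidate p u t p+u+t+R d∤p+u+A (λ d∣t+B → t≢p (∣toℕ+-injective t p B d∣t+B d∣p+B))
    ...   | yes d∣p+u+A = candidate p t u p+t+u+R
              (λ d∣p+t+A → u≢t (∣toℕ+-injective u t (toℕ p + A)
                                  (swap (toℕ p) (toℕ u) d∣p+u+A) (swap (toℕ p) (toℕ t) d∣p+t+A)))
              (λ d∣u+B → u≢p (∣toℕ+-injective u p B d∣u+B d∣p+B))
    halve | no d∤p+B with d ∣? (toℕ t + (toℕ u + A))
    ...   | no  d∤t+u+A = candidate t u p t+u+p+R d∤t+u+A d∤p+B
    ...   | yes d∣t+u+A with d ∣? (toℕ t + B)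
    ...     | no  d∤t+B = candidate p u t p+u+t+R
              (λ d∣p+u+A → t≢p (∣toℕ+-injective t p (toℕ u + A) d∣t+u+A d∣p+u+A)) d∤t+B
    ...     | yes d∣t+B = candidate p t u p+t+u+R
              (λ d∣p+t+A → u≢p (∣toℕ+-injective u p (toℕ t + A) (swap (toℕ t) (toℕ u) d∣t+u+A) d∣p+t+A))
              (λ d∣u+B → u≢t (∣toℕ+-injective u t B d∣u+B d∣t+B))

  module Light (c : Fin d → ℕ) (sum-c : sum c ≡ q + q) (light : ∀ r → c r < q) where

    sum-positive : 0 < sum c
    sum-positive = subst (0 <_) (sym sum-c) (≤-trans (>-nonZero⁻¹ q) (m≤m+n q q))

    two-below-sum : ∀ r r′ → c r + c r′ < sum c
    two-below-sum r r′ = subst (c r + c r′ <_) (sym sum-c) (+-mono-< (light r) (light r′))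

    halve : Halving c
    halve with p , cp-positive ← ∃-positive c sum-positive
          with t , t≢p , _ , ct-positive ← positive-outside c p p (two-below-sum p p)
          with u , u≢p , u≢t , cu-positive ← positive-outside c p t (two-below-sum p t) =
      Triple.halve c t≢p u≢p u≢t R p+t+u+R (q ∸ 2) 2+q″≡q sum-R
      where
      c₁ c₂ R : Fin d → ℕ
      c₁ = removeMass p 1 c
      c₂ = removeMass t 1 c₁
      R  = removeMass u 1 c₂

      c₁t-positive : 0 < c₁ t
      c₁t-positive = subst (0 <_) (sym (removeMass-other {c = c} 1 t≢p)) ct-positive

      c₂u-positive : 0 < c₂ u
      c₂u-positive = subst (0 <_) (sym (trans (removeMass-other {c = c₁} 1 u≢t) (removeMass-other {c = c} 1 u≢p)))
                           cu-positive

      p+t+u+R : ∀ r → pointMass p 1 r + (pointMass t 1 r + (pointMass u 1 r + R r)) ≡ c r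
      p+t+u+R r = begin
        pointMass p 1 r + (pointMass t 1 r + (pointMass u 1 r + R r))
          ≡⟨ cong (λ x → pointMass p 1 r + (pointMass t 1 r + x)) (pointMass+removeMass u 1 c₂u-positive r) ⟩
        pointMass p 1 r + (pointMass t 1 r + c₂ r)
          ≡⟨ cong (_+_ (pointMass p 1 r)) (pointMass+removeMass t 1 c₁t-positive r) ⟩
        pointMass p 1 r + c₁ r
          ≡⟨ pointMass+removeMass p 1 cp-positive r ⟩
        c r ∎
        where open ≡-Reasoning

      2+q″≡q : 2 + (q ∸ 2) ≡ q
      2+q″≡q = m+[n∸m]≡n (≤-trans (s≤s cp-positive) (light p))

      sum-R : sum R ≡ (q ∸ 2) + suc (q ∸ 2)
      sum-R = suc-injective (trans (suc-injective (suc-injective (begin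
        3 + sum R                               ≡⟨ cong (_+_ 2) (sum-removeMass u 1 c₂u-positive) ⟩
        2 + sum c₂                              ≡⟨ cong suc (sum-removeMass t 1 c₁t-positive) ⟩
        1 + sum c₁                              ≡⟨ sum-removeMass p 1 cp-positive ⟩
        sum c                                   ≡⟨ sum-c ⟩
        q + q                                   ≡⟨ cong₂ _+_ 2+q″≡q 2+q″≡q ⟨
        (2 + (q ∸ 2)) + (2 + (q ∸ 2))           ∎))) (+-suc (q ∸ 2) (suc (q ∸ 2))))
        where open ≡-Reasoning

  halve : ∀ c → sum c ≡ q + q → Halving c
  halve c sum-c with any? (λ b → q ≤? c b)
  ... | yes (b , q≤cb) = Heavy.halve c sum-c b q≤cb
  ... | no  none       = Light.halve c sum-c (λ r → ≰⇒> (λ q≤cr → none (r , q≤cr)))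

  record Decomposition (m : ℕ) (c : Fin d → ℕ) : Set where
    field
      row        : Fin m → Fin d → ℕ
      column-sum : ∀ r → sum (λ s → row s r) ≡ c r
      row-sum    : ∀ s → sum (row s) ≡ q
      admissible : ∀ s → Admissible (row s)

  decompose : ∀ m (c : Fin d → ℕ) → sum c ≡ q + (q + m * q) → Decomposition (2 + m) c
  decompose zero c sum-c = record
    { row        = left ∷ right ∷ []
    ; column-sum = λ r → trans (cong (_+_ (left r)) (+-identityʳ (right r))) (left+right r)
    ; row-sum    = λ { zero → sum-left ; (suc zero) → sum-right }
    ; admissible = λ { zero → admissible-left ; (suc zero) → admissible-right }
    }
    where open Halving (halve c (trans sum-c (cong (_+_ q) (+-identityʳ q))))
  -- Halve 2q of the counts, keep one half as a row and return the other to the remaining counts.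
  decompose (suc m) c sum-c = record
    { row        = left ∷ row
    ; column-sum = λ r → trans (cong (_+_ (left r)) (column-sum r))
                     (trans (sym (+-assoc (left r) (right r) (second r)))
                            (trans (cong (_+ second r) (left+right r)) (first+second r)))
    ; row-sum    = λ { zero → sum-left ; (suc s) → row-sum s }
    ; admissible = λ { zero → admissible-left ; (suc s) → admissible s }
    }
    where
    open Split (split c (q + q) (q + m * q) (trans sum-c (sym (+-assoc q q _))))
    open Halving (halve first sum-first)
    open Decomposition (decompose m (λ r → right r + second r)
                                  (trans (∑-distrib-+ right second) (cong₂ _+_ sum-right sum-second)))

residue : ∀ d .{{_ : NonZero d}} → ℤ → Fin d
residue d x = fromℕ< (n%ℕd<d x d)

residue-quotient : ∀ d .{{_ : NonZero d}} x → x ≡ + toℕ (residue d x) ℤ.+ (x /ℕ d) ℤ.* + d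
residue-quotient d x =
  trans (a≡a%ℕn+[a/ℕn]*n x d) (cong (λ r → + r ℤ.+ (x /ℕ d) ℤ.* + d) (sym (toℕ-fromℕ< (n%ℕd<d x d))))

residue-≡⇒≡-mod : ∀ d .{{_ : NonZero d}} {x y} → residue d x ≡ residue d y → x ≡ y [mod d ]
residue-≡⇒≡-mod d {x} {y} same = ℤ∣.∣⇒∣ᵤ (ℤ∣.divides (x /ℕ d ℤ.- y /ℕ d) (begin
  x ℤ.- y
    ≡⟨ cong₂ ℤ._-_ (residue-quotient d x)
                   (trans (residue-quotient d y) (cong (λ r → + toℕ r ℤ.+ (y /ℕ d) ℤ.* + d) (sym same))) ⟩
  (+ toℕ (residue d x) ℤ.+ (x /ℕ d) ℤ.* + d) ℤ.- (+ toℕ (residue d x) ℤ.+ (y /ℕ d) ℤ.* + d)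
    ≡⟨ cancel (+ toℕ (residue d x)) (x /ℕ d) (y /ℕ d) (+ d) ⟩
  (x /ℕ d ℤ.- y /ℕ d) ℤ.* + d ∎))
  where
  open ≡-Reasoning
  cancel : ∀ r a b e → (r ℤ.+ a ℤ.* e) ℤ.- (r ℤ.+ b ℤ.* e) ≡ (a ℤ.- b) ℤ.* e
  cancel = ℤSolver.solve-∀

∣blockSum⇒∣weight : ∀ {N d m} .{{_ : NonZero d}} (a : Fin N → ℤ) (M : Fin m → Fin d → ℕ)
                    (counts : ColourCounts (residue d ∘ a) M) s →
                    + d ℤDiv.∣ blockSum (realise (residue d ∘ a) M counts) s a → d ∣ weight (M s)
∣blockSum⇒∣weight {N} {d} {m} a M counts s d∣sum = ℤ∣.∣⇒∣ᵤ {+ d} {+ weight (M s)}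
  (ℤ∣.∣m+n∣n⇒∣m (subst (ℤ∣._∣_ (+ d)) split-by-residue (ℤ∣.∣ᵤ⇒∣ d∣sum)) (ℤ∣.∣n⇒∣m*n quotients ℤ∣.∣-refl))
  where
  f : Fin N → Fin m
  f = realise (residue d ∘ a) M counts
  quotients : ℤ
  quotients = blockSum f s (λ i → a i /ℕ d)
  split-by-residue : blockSum f s a ≡ + weight (M s) ℤ.+ quotients ℤ.* + d
  split-by-residue = trans (blockSum-linear f s (+ d) (λ i → residue-quotient d (a i)))
                           (cong (ℤ._+ quotients ℤ.* + d) (blockSum-realise (residue d ∘ a) M counts s))

lemma2p1 : (m q d : ℕ) → 2 ≤ m → 1 ≤ q → 1 ≤ d → d ∣ q → (a : Fin (m * q) → ℤ) →
    Σ (Fin (m * q) → Fin m) (λ f → (s : Fin m) →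
      (blockSize f s ≡ q) ×
      ((+ d) ℤDiv.∣ blockSum f s a → (i j : Fin (m * q)) → f i ≡ s → f j ≡ s → a i ≡ a j [mod d ]))
lemma2p1 zero          _         _         ()      _  _  _   _
lemma2p1 (suc zero)    _         _         (s≤s ()) _ _  _   _
lemma2p1 (suc (suc m)) zero      _         _       () _  _   _
lemma2p1 (suc (suc m)) (suc _)   zero      _       _  () _   _
lemma2p1 (suc (suc m)) q@(suc _) d@(suc _) _       _  _  d∣q a = f , λ s → size s , congruent s
  where
  col : Fin (suc (suc m) * q) → Fin d
  col i = residue d (a i)

  open AdmissibleBlocks d∣q using (module Decomposition; decompose)
  open Decomposition (decompose m (blockSize col) (sum-blockSize col))

  f : Fin (suc (suc m) * q) → Fin (suc (suc m))
  f = realise col row column-sum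

  size : ∀ s → blockSize f s ≡ q
  size s = trans (blockSize-realise col row column-sum s) (row-sum s)

  congruent : ∀ s → + d ℤDiv.∣ blockSum f s a → ∀ i j → f i ≡ s → f j ≡ s → a i ≡ a j [mod d ]
  congruent s d∣sum i j fi≡s fj≡s = residue-≡⇒≡-mod d {a i} {a j}
    (admissible s (∣blockSum⇒∣weight a row column-sum s d∣sum) (col i) (col j)
                (realise-positive col row column-sum i s fi≡s) (realise-positive col row column-sum j s fj≡s))
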